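{- Let $\mathcal{S}$ be a move sequence and $C=(c_1,\dots,c_t)$ a cycle of $\mathcal{S}$. If $C$ is dependent with respect to some $\tau_0\in\{\pm1\}^{V(\mathcal{S})}$ with witnessing vector $b\in\{\pm1\}^t$, then $C$ is dependent with respect to every $\tau_0'\in\{\pm1\}^{V(\mathcal{S})}$, with the same vector $b$.
   Context: A move sequence over $V_n=[n]$ is $\mathcal{S}=(\mathcal{S}_1,\dots,\mathcal{S}_\ell)$ with each $\mathcal{S}_i\subseteq V_n$ of size 1 or 2; $V(\mathcal{S})$ is the set of nodes occurring in it. For $\tau_0\in\{\pm1\}^{V(\mathcal{S})}$, $\tau_i$ is obtained from $\tau_{i-1}$ by flipping the signs of the nodes in $\mathcal{S}_i$. A cycle of $\mathcal{S}$ is a tuple $C=(c_1,\dots,c_t)$, $t\ge2$, of distinct indices such that $\mathcal{S}_{c_j}=\{u_j,u_{j+1}\}$ for $j\in[t-1]$ and $\mathcal{S}_{c_t}=\{u_t,u_1\}$ for some nodes $u_1,\dots,u_t$. $C$ is dependent with respect to $\tau_0$ (witnessed by $b$) if $b\in\{\pm1\}^t$ satisfies $b_j\tau_{c_j}(u_{j+1})+b_{j+1}\tau_{c_{j+1}}(u_{j+1})=0$ for all $j\in[t-1]$ and $b_t\tau_{c_t}(u_1)+b_1\tau_{c_1}(u_1)=0$, where $\tau_0,\tau_1,\dots$ are induced from $\tau_0$. -}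

module Defs where

open import Data.Nat using (ℕ; zero; suc; _≤_; _<?_)
open import Data.Fin using (Fin; toℕ; fromℕ<)
import Data.Fin as Fin
open import Data.Fin.Subset using (Subset; _∈_; _∪_; ⁅_⁆; ∣_∣)
open import Data.Fin.Subset.Properties using (x∈p∪q⁺; x∈⁅x⁆)
open import Data.Vec using (Vec)
import Data.Vec as Vec
open import Data.Vec.Relation.Unary.Any using ()
open import Data.Vec.Properties using ([]=⇒lookup; lookup⇒[]=)
open import Data.List using (List; []; _∷_; length; foldl; take)
import Data.List as List
open import Data.List.Relation.Unary.All using (All)
open import Data.Bool using (Bool; true; false; T; if_then_else_)
open import Data.Unit using (tt)
open import Data.Sign using (Sign; opposite)
open import Data.Integer using (ℤ; _◃_; _*_; _+_; 0ℤ)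
open import Data.Product using (Σ; _,_)
open import Data.Sum using (_⊎_; inj₁; inj₂)
open import Function.Definitions using (Injective)
open import Relation.Binary.PropositionalEquality using (_≡_; subst; sym)
open import Relation.Nullary using (yes; no)

-- A move: a subset of V_n = Fin n (nodes 0..n-1 stand for 1..n).
Move : ℕ → Set
Move n = Subset n

-- A move sequence S_1..S_ℓ is a list of moves, each of size 1 or 2.
-- Move S_i (1-indexed) is  List.lookup S k  with  toℕ k = i - 1.
IsMoveSequence : {n : ℕ} → List (Move n) → Set
IsMoveSequence S = All (λ m → ∣ m ∣ ≡ 1 ⊎ ∣ m ∣ ≡ 2) S

V : {n : ℕ} → List (Move n) → Subset n
V []      = Data.Fin.Subset.⊥
V (m ∷ S) = m ∪ V S

-- The index set V(S) as a type (membership proofs are in ⊤, so irrelevant).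
Dom : {n : ℕ} → List (Move n) → Set
Dom {n} S = Σ (Fin n) (λ u → T (Vec.lookup (V S) u))

SignVec : {n : ℕ} → List (Move n) → Set
SignVec S = Dom S → Sign

toℤ : Sign → ℤ
toℤ s = s ◃ 1

flip : {n : ℕ} (S : List (Move n)) → Move n → SignVec S → SignVec S
flip S m τ (u , p) = if Vec.lookup m u then opposite (τ (u , p)) else τ (u , p)

applyMoves : {n : ℕ} (S : List (Move n)) → List (Move n) → SignVec S → SignVec S
applyMoves S ms τ = foldl (λ σ m → flip S m σ) τ ms

tau : {n : ℕ} (S : List (Move n)) → SignVec S → ℕ → SignVec S
tau S τ₀ i = applyMoves S (take i S) τ₀

next : {t : ℕ} → Fin t → Fin t
next {suc t} i with suc (toℕ i) <? suc t
... | yes p = fromℕ< p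
... | no _  = Fin.zero

record Cycle {n : ℕ} (S : List (Move n)) : Set where
  field
    t     : ℕ
    t≥2   : 2 ≤ t
    c     : Fin t → Fin (length S)
    c-inj : Injective _≡_ _≡_ c
    u     : Fin t → Fin n
    edge  : ∀ j → List.lookup S (c j) ≡ ⁅ u j ⁆ ∪ ⁅ u (next j) ⁆

∈⇒T : {n : ℕ} {p : Subset n} {x : Fin n} → x ∈ p → T (Vec.lookup p x)
∈⇒T {p = p} {x} q = subst T (sym ([]=⇒lookup q)) tt

T⇒∈ : {n : ℕ} (p : Subset n) (x : Fin n) → T (Vec.lookup p x) → x ∈ p
T⇒∈ p x t with Vec.lookup p x in eq
... | true = lookup⇒[]= x p eq

∈move⇒V : {n : ℕ} (S : List (Move n)) (k : Fin (length S)) (x : Fin n) →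
          x ∈ List.lookup S k → T (Vec.lookup (V S) x)
∈move⇒V (m ∷ S) Fin.zero x p = ∈⇒T (x∈p∪q⁺ {p = m} {q = V S} (inj₁ p))
∈move⇒V (m ∷ S) (Fin.suc k) x p =
  ∈⇒T (x∈p∪q⁺ {p = m} {q = V S} (inj₂ (T⇒∈ (V S) x (∈move⇒V S k x p))))

module _ {n : ℕ} {S : List (Move n)} (C : Cycle S) where
  open Cycle C

  inPrev : (j : Fin t) → Dom S
  inPrev j = u (next j) , ∈move⇒V S (c j) (u (next j))
    (subst (u (next j) ∈_) (sym (edge j))
      (x∈p∪q⁺ {p = ⁅ u j ⁆} (inj₂ (x∈⁅x⁆ (u (next j))))))

  inNext : (j : Fin t) → Dom S
  inNext j = u (next j) , ∈move⇒V S (c (next j)) (u (next j))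
    (subst (u (next j) ∈_) (sym (edge (next j)))
      (x∈p∪q⁺ {q = ⁅ u (next (next j)) ⁆} (inj₁ (x∈⁅x⁆ (u (next j))))))

-- C is dependent w.r.t. τ₀, witnessed by b ∈ {±1}^t:
--   b_j τ_{c_j}(u_{j+1}) + b_{j+1} τ_{c_{j+1}}(u_{j+1}) = 0 for all j (cyclically).
-- Here c_j (1-indexed move position) is  suc (toℕ (c j)).
Dependent : {n : ℕ} (S : List (Move n)) (C : Cycle S) → SignVec S →
            (Fin (Cycle.t C) → Sign) → Set
Dependent S C τ₀ b = ∀ j →
  toℤ (b j) * toℤ (tau S τ₀ (suc (toℕ (c j))) (inPrev C j))
  + toℤ (b (next j)) * toℤ (tau S τ₀ (suc (toℕ (c (next j)))) (inNext C j))
  ≡ 0ℤ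
  where open Cycle C

-- Flipping a node commutes with multiplying it by a fixed sign, so two initial
-- assignments τ₀, τ₀′ keep their pointwise ratio s = τ₀′ τ₀ through every move:
-- τ′ᵢ(v) = s(v) τᵢ(v) for all i. Both terms of the dependence equation at index j
-- are evaluated at the same node u_{j+1}, so passing from τ₀ to τ₀′ multiplies the
-- whole equation by the single sign s(u_{j+1}), which keeps it equal to zero.
module Submission where

open import Defs
open import Data.Nat using (ℕ; suc)
open import Data.Fin using (Fin; toℕ)
open import Data.List using (List; []; _∷_; take)
open import Data.Bool using (true; false)
open import Data.Bool.Properties using (T-irrelevant)
open import Data.Product using (_,_)
open import Data.Sign using (Sign; opposite) renaming (_*_ to _*ₛ_)
import Data.Sign as Sign
import Data.Sign.Properties as Sign
open import Data.Integer using (ℤ; _*_; _+_; 0ℤ)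
open import Data.Integer.Properties using (◃-distrib-*; *-distribˡ-+; *-zeroʳ; *-commutativeSemigroup)
open import Algebra.Properties.CommutativeSemigroup *-commutativeSemigroup using (x∙yz≈y∙xz)
import Data.Vec as Vec
open import Relation.Binary.PropositionalEquality

opposite-*ʳ : ∀ s a → opposite (s *ₛ a) ≡ s *ₛ opposite a
opposite-*ʳ Sign.+ _ = refl
opposite-*ʳ Sign.- _ = refl

toℤ-* : ∀ s t → toℤ (s *ₛ t) ≡ toℤ s * toℤ t
toℤ-* s t = ◃-distrib-* s t 1 1

s≡[s*t]*t : ∀ s t → s ≡ (s *ₛ t) *ₛ t
s≡[s*t]*t s t = sym (begin
  (s *ₛ t) *ₛ t  ≡⟨ Sign.*-assoc s t t ⟩
  s *ₛ (t *ₛ t)  ≡⟨ cong (s *ₛ_) (Sign.s*s≡+ t) ⟩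
  s *ₛ Sign.+    ≡⟨ Sign.*-identityʳ s ⟩
  s              ∎)
  where open ≡-Reasoning

scaled-combination≡0 : ∀ (a b c x y : ℤ) → a * x + b * y ≡ 0ℤ →
                       a * (c * x) + b * (c * y) ≡ 0ℤ
scaled-combination≡0 a b c x y eq = begin
  a * (c * x) + b * (c * y)  ≡⟨ cong₂ _+_ (x∙yz≈y∙xz a c x) (x∙yz≈y∙xz b c y) ⟩
  c * (a * x) + c * (b * y)  ≡⟨ *-distribˡ-+ c (a * x) (b * y) ⟨
  c * (a * x + b * y)        ≡⟨ cong (c *_) eq ⟩
  c * 0ℤ                     ≡⟨ *-zeroʳ c ⟩
  0ℤ                         ∎
  where open ≡-Reasoning

module _ {n : ℕ} (S : List (Move n)) where

  _⊙_ : (Dom S → Sign) → SignVec S → SignVec S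
  (s ⊙ τ) v = s v *ₛ τ v

  flip-⊙ : ∀ m s {τ σ} → σ ≗ s ⊙ τ → flip S m σ ≗ s ⊙ flip S m τ
  flip-⊙ m s {τ} σ≗sτ (u , p) with Vec.lookup m u
  ... | true  = trans (cong opposite (σ≗sτ (u , p))) (opposite-*ʳ (s (u , p)) (τ (u , p)))
  ... | false = σ≗sτ (u , p)

  applyMoves-⊙ : ∀ ms s {τ σ} → σ ≗ s ⊙ τ → applyMoves S ms σ ≗ s ⊙ applyMoves S ms τ
  applyMoves-⊙ []       s σ≗sτ = σ≗sτ
  applyMoves-⊙ (m ∷ ms) s σ≗sτ = applyMoves-⊙ ms s (flip-⊙ m s σ≗sτ)

  tau-⊙ : ∀ s {τ₀ σ₀} → σ₀ ≗ s ⊙ τ₀ → ∀ i → tau S σ₀ i ≗ s ⊙ tau S τ₀ i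
  tau-⊙ s σ₀≗sτ₀ i = applyMoves-⊙ (take i S) s σ₀≗sτ₀

  inPrev≡inNext : (C : Cycle S) (j : Fin (Cycle.t C)) → inPrev C j ≡ inNext C j
  inPrev≡inNext C j = cong (Cycle.u C (next j) ,_) (T-irrelevant _ _)

lemma2p6 : {n : ℕ} (S : List (Move n)) → IsMoveSequence S →
           (C : Cycle S) (τ₀ : SignVec S) (b : Fin (Cycle.t C) → Sign) →
           Dependent S C τ₀ b → (τ₀′ : SignVec S) → Dependent S C τ₀′ b
lemma2p6 S _ C τ₀ b dep τ₀′ j = begin
  toℤ (b j) * toℤ (τ′ i P) + toℤ (b (next j)) * toℤ (τ′ i′ Q)
    ≡⟨ cong₂ (λ x y → toℤ (b j) * toℤ x + toℤ (b (next j)) * toℤ y)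
             (ratio-kept i P) (ratio-kept i′ Q) ⟩
  toℤ (b j) * toℤ (s P *ₛ τ i P) + toℤ (b (next j)) * toℤ (s Q *ₛ τ i′ Q)
    ≡⟨ cong₂ (λ x y → toℤ (b j) * x + toℤ (b (next j)) * y)
             (toℤ-* (s P) (τ i P))
             (trans (cong (λ v → toℤ (s v *ₛ τ i′ Q)) (sym (inPrev≡inNext S C j)))
                    (toℤ-* (s P) (τ i′ Q))) ⟩
  toℤ (b j) * (toℤ (s P) * toℤ (τ i P)) + toℤ (b (next j)) * (toℤ (s P) * toℤ (τ i′ Q))
    ≡⟨ scaled-combination≡0 (toℤ (b j)) (toℤ (b (next j))) (toℤ (s P)) _ _ (dep j) ⟩
  0ℤ ∎
  where
  open Cycle C
  open ≡-Reasoning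
  s : Dom S → Sign
  s v = τ₀′ v *ₛ τ₀ v
  τ τ′ : ℕ → SignVec S
  τ  = tau S τ₀
  τ′ = tau S τ₀′
  ratio-kept : ∀ i → τ′ i ≗ _⊙_ S s (τ i)
  ratio-kept = tau-⊙ S s (λ v → s≡[s*t]*t (τ₀′ v) (τ₀ v))
  i i′ : ℕ
  i  = suc (toℕ (c j))
  i′ = suc (toℕ (c (next j)))
  P Q : Dom S
  P = inPrev C j
  Q = inNext C j
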